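{- Let $G$ be a triangle-free graph on $n$ vertices with $m$ edges. Then $\sigma_{t}(G)\leq m(n^{2}-4m)$, with equality if and only if $G$ is a complete bipartite graph.
   Context: For a finite simple graph $G$ with $d(v)$ the degree of $v$, $\sigma_{t}(G)=\sum_{\{u,v\}\subseteq V(G)}(d(u)-d(v))^{2}$, summing over all unordered pairs of distinct vertices. -}

module Defs where

open import Data.Bool using (Bool; true; false; if_then_else_)
open import Data.Fin using (Fin; toℕ)
open import Data.List using (List; map; allFin)
open import Data.Nat using (ℕ; _<ᵇ_)
open import Data.Integer using (ℤ; _+_; _-_; _*_; 0ℤ; 1ℤ)
open import Data.Product using (Σ; ∃; _×_)
open import Data.Empty using (⊥)
open import Relation.Binary.PropositionalEquality using (_≡_)
open import Relation.Nullary using (¬_)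

record SimpleGraph (n : ℕ) : Set where
  field
    adj    : Fin n → Fin n → Bool
    sym    : ∀ u v → adj u v ≡ adj v u
    irrefl : ∀ v → adj v v ≡ false
open SimpleGraph public

sumℤ : List ℤ → ℤ
sumℤ Data.List.[] = 0ℤ
sumℤ (x Data.List.∷ xs) = x + sumℤ xs

Σv : {n : ℕ} → (Fin n → ℤ) → ℤ
Σv {n} f = sumℤ (map f (allFin n))

Σpairs : {n : ℕ} → (Fin n → Fin n → ℤ) → ℤ
Σpairs f = Σv λ u → Σv λ v → if toℕ u <ᵇ toℕ v then f u v else 0ℤ

b2z : Bool → ℤ
b2z true = 1ℤ
b2z false = 0ℤ

degree : {n : ℕ} → SimpleGraph n → Fin n → ℤ
degree G u = Σv λ v → b2z (adj G u v)

edgeCount : {n : ℕ} → SimpleGraph n → ℤ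
edgeCount G = Σpairs λ u v → b2z (adj G u v)

sigmaT : {n : ℕ} → SimpleGraph n → ℤ
sigmaT G = Σpairs λ u v → (degree G u - degree G v) * (degree G u - degree G v)

TriangleFree : {n : ℕ} → SimpleGraph n → Set
TriangleFree G = ∀ u v w → ¬ (adj G u v ≡ true × adj G v w ≡ true × adj G u w ≡ true)

-- complete bipartite: a 2-colouring (parts may be empty) such that
-- u ~ v iff u and v lie in different parts
IsCompleteBipartite : {n : ℕ} → SimpleGraph n → Set
IsCompleteBipartite {n} G =
  Σ (Fin n → Bool) λ c → ∀ u v → (adj G u v ≡ true → ¬ (c u ≡ c v)) × (¬ (c u ≡ c v) → adj G u v ≡ true)

{-# OPTIONS --safe #-}

-- Lagrange's identity gives σ_t(G) = n M − (Σ d)² with M = Σ d(v)², and Σ d = 2m, so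
-- m(n² − 4m) − σ_t(G) = n (n m − M).  Summing n − d(u) − d(v) over the ordered edges uv
-- gives 2 (n m − M).  In a triangle-free graph adjacent vertices have disjoint
-- neighbourhoods, so every summand is nonnegative, whence σ_t(G) ≤ m(n² − 4m).  Equality
-- means that for every edge uv each vertex is adjacent to u or to v; with no triangles,
-- N(v₀) and its complement are then the two sides of a complete bipartite graph for any v₀
-- on an edge.  Conversely, in a complete bipartite graph d(u) + d(v) = n along every edge.

module Submission where

open import Defs hiding (sym)
open import Data.Bool using (Bool; true; false; if_then_else_; _xor_; _≟_)
open import Data.Bool.Properties using (not-¬)
open import Data.Empty using (⊥-elim)
open import Data.Fin using (Fin; zero; suc; toℕ)
open import Data.Fin.Properties using (toℕ-injective; any?)
open import Data.Integer using (ℤ; _≤_; _*_; _-_; +_; _+_; 0ℤ; 1ℤ; +≤+)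
import Data.Integer.Properties as ℤ
open import Data.Integer.Tactic.RingSolver using (solve-∀)
open import Data.List using (map; tabulate)
open import Data.Nat using (ℕ; zero; suc; z≤n; _<ᵇ_)
import Data.Nat.Properties as ℕ
open import Data.Product using (_×_; _,_; proj₁; proj₂)
open import Data.Sum using (_⊎_; inj₁; inj₂)
open import Data.Vec.Functional using (removeAt)
open import Function using (_∘_; id)
open import Function.Bundles using (_⇔_; mk⇔)
open import Relation.Binary.PropositionalEquality
  using (_≡_; refl; sym; trans; cong; cong₂; subst; module ≡-Reasoning)
open import Relation.Nullary using (¬_; yes; no)
open import Relation.Nullary.Reflects using (ofʸ; ofⁿ)

open import Algebra.Properties.Semiring.Sum ℤ.+-*-semiring

private variable
  n : ℕ

sumℤ-map-tabulate : ∀ {A : Set} (g : Fin n → A) (f : A → ℤ) →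
  sumℤ (map f (tabulate g)) ≡ ∑[ i < n ] f (g i)
sumℤ-map-tabulate {zero}  g f = refl
sumℤ-map-tabulate {suc n} g f = cong (_+_ (f (g zero))) (sumℤ-map-tabulate (g ∘ suc) f)

Σv≡∑ : (f : Fin n → ℤ) → Σv f ≡ ∑[ i < n ] f i
Σv≡∑ = sumℤ-map-tabulate id

∑-const : ∀ n c → ∑[ i < n ] c ≡ + n * c
∑-const zero    c = sym (ℤ.*-zeroˡ c)
∑-const (suc n) c = trans (cong (_+_ c) (∑-const n c)) (sym (ℤ.suc-* (+ n) c))

∑-distrib-- : (f g : Fin n → ℤ) → ∑[ i < n ] (f i - g i) ≡ ∑[ i < n ] f i - ∑[ i < n ] g i
∑-distrib-- {zero}  f g = refl
∑-distrib-- {suc n} f g =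
  trans (cong (_+_ (f zero - g zero)) (∑-distrib-- (f ∘ suc) (g ∘ suc)))
        (interchange (f zero) (g zero) _ _)
  where
  interchange : ∀ a b c d → (a - b) + (c - d) ≡ (a + c) - (b + d)
  interchange = solve-∀

∑-mono-≤ : {f g : Fin n → ℤ} → (∀ i → f i ≤ g i) → ∑[ i < n ] f i ≤ ∑[ i < n ] g i
∑-mono-≤ {zero}  f≤g = ℤ.≤-refl
∑-mono-≤ {suc n} f≤g = ℤ.+-mono-≤ (f≤g zero) (∑-mono-≤ (f≤g ∘ suc))

∑-nonneg : {f : Fin n → ℤ} → (∀ i → 0ℤ ≤ f i) → 0ℤ ≤ ∑[ i < n ] f i
∑-nonneg {n} {f} f≥0 = subst (_≤ sum f) (sum-replicate-zero n) (∑-mono-≤ f≥0)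

∑-zero : {f : Fin n → ℤ} → (∀ i → f i ≡ 0ℤ) → ∑[ i < n ] f i ≡ 0ℤ
∑-zero {n} f≡0 = trans (sum-cong-≗ f≡0) (sum-replicate-zero n)

∑-nonneg-≡0 : {f : Fin n → ℤ} → (∀ i → 0ℤ ≤ f i) →
  ∑[ i < n ] f i ≡ 0ℤ → ∀ i → f i ≡ 0ℤ
∑-nonneg-≡0 {suc n} {f} f≥0 ∑f≡0 i = ℤ.≤-antisym fᵢ≤0 (f≥0 i)
  where
  open ℤ.≤-Reasoning
  fᵢ≤0 : f i ≤ 0ℤ
  fᵢ≤0 = begin
    f i                         ≡⟨ ℤ.+-identityʳ (f i) ⟨
    f i + 0ℤ                    ≤⟨ ℤ.+-monoʳ-≤ (f i) (∑-nonneg {f = removeAt f i} (λ _ → f≥0 _)) ⟩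
    f i + sum (removeAt f i)    ≡⟨ sum-remove {i = i} f ⟨
    sum f                       ≡⟨ ∑f≡0 ⟩
    0ℤ                          ∎

∑∑-nonneg-≡0 : {g : Fin n → Fin n → ℤ} → (∀ u v → 0ℤ ≤ g u v) →
  ∑[ u < n ] ∑[ v < n ] g u v ≡ 0ℤ → ∀ u v → g u v ≡ 0ℤ
∑∑-nonneg-≡0 g≥0 ∑∑g≡0 u = ∑-nonneg-≡0 (g≥0 u) (∑-nonneg-≡0 (λ u → ∑-nonneg (g≥0 u)) ∑∑g≡0 u)

Symmetric : (Fin n → Fin n → ℤ) → Set
Symmetric g = ∀ u v → g u v ≡ g v u

ZeroDiagonal : (Fin n → Fin n → ℤ) → Set
ZeroDiagonal g = ∀ u → g u u ≡ 0ℤ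

aboveDiagonal : (Fin n → Fin n → ℤ) → Fin n → Fin n → ℤ
aboveDiagonal g u v = if toℕ u <ᵇ toℕ v then g u v else 0ℤ

aboveDiagonal-+-transpose : {g : Fin n → Fin n → ℤ} → Symmetric g → ZeroDiagonal g →
  ∀ u v → aboveDiagonal g u v + aboveDiagonal g v u ≡ g u v
aboveDiagonal-+-transpose {g = g} sym-g diag-g u v
  with toℕ u <ᵇ toℕ v | ℕ.<ᵇ-reflects-< (toℕ u) (toℕ v)
     | toℕ v <ᵇ toℕ u | ℕ.<ᵇ-reflects-< (toℕ v) (toℕ u)
... | true  | ofʸ u<v | true  | ofʸ v<u = ⊥-elim (ℕ.<-asym u<v v<u)
... | true  | _       | false | _       = ℤ.+-identityʳ (g u v)
... | false | _       | true  | _       = trans (ℤ.+-identityˡ (g v u)) (sym-g v u)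
... | false | ofⁿ u≮v | false | ofⁿ v≮u = begin
  0ℤ      ≡⟨ diag-g u ⟨
  g u u   ≡⟨ cong (g u) u≡v ⟩
  g u v   ∎
  where
  open ≡-Reasoning
  u≡v : u ≡ v
  u≡v = toℕ-injective (ℕ.≤-antisym (ℕ.≮⇒≥ v≮u) (ℕ.≮⇒≥ u≮v))

∑∑-symmetrize : (g : Fin n → Fin n → ℤ) →
  ∑[ u < n ] ∑[ v < n ] (g u v + g v u) ≡ + 2 * ∑[ u < n ] ∑[ v < n ] g u v
∑∑-symmetrize {n} g = begin
  ∑[ u < n ] ∑[ v < n ] (g u v + g v u)
    ≡⟨ sum-cong-≗ (λ u → ∑-distrib-+ (g u) (λ v → g v u)) ⟩
  ∑[ u < n ] (∑[ v < n ] g u v + ∑[ v < n ] g v u)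
    ≡⟨ ∑-distrib-+ (λ u → ∑[ v < n ] g u v) (λ u → ∑[ v < n ] g v u) ⟩
  S + ∑[ u < n ] ∑[ v < n ] g v u
    ≡⟨ cong (_+_ S) (∑-comm g) ⟨
  S + S
    ≡⟨ double S ⟨
  + 2 * S
    ∎
  where
  open ≡-Reasoning
  S = ∑[ u < n ] ∑[ v < n ] g u v
  double : ∀ x → + 2 * x ≡ x + x
  double = solve-∀

Σpairs-double : {g : Fin n → Fin n → ℤ} → Symmetric g → ZeroDiagonal g →
  + 2 * Σpairs g ≡ ∑[ u < n ] ∑[ v < n ] g u v
Σpairs-double {n} {g} sym-g diag-g = begin
  + 2 * Σpairs g
    ≡⟨ cong (+ 2 *_) (trans (Σv≡∑ (λ u → Σv (aboveDiagonal g u)))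
                            (sum-cong-≗ (λ u → Σv≡∑ (aboveDiagonal g u)))) ⟩
  + 2 * ∑[ u < n ] ∑[ v < n ] aboveDiagonal g u v
    ≡⟨ ∑∑-symmetrize (aboveDiagonal g) ⟨
  ∑[ u < n ] ∑[ v < n ] (aboveDiagonal g u v + aboveDiagonal g v u)
    ≡⟨ sum-cong-≗ (λ u → sum-cong-≗ (aboveDiagonal-+-transpose sym-g diag-g u)) ⟩
  ∑[ u < n ] ∑[ v < n ] g u v
    ∎
  where open ≡-Reasoning

∑∑-square-difference : (f : Fin n → ℤ) →
  ∑[ u < n ] ∑[ v < n ] ((f u - f v) * (f u - f v))
    ≡ + 2 * (+ n * ∑[ u < n ] (f u * f u) - ∑[ u < n ] f u * ∑[ u < n ] f u)
∑∑-square-difference {n} f = begin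
  ∑[ u < n ] ∑[ v < n ] ((f u - f v) * (f u - f v))
    ≡⟨ sum-cong-≗ (λ u → sum-cong-≗ (λ v → square-split (f u) (f v))) ⟩
  ∑[ u < n ] ∑[ v < n ] (h u v + h v u)
    ≡⟨ ∑∑-symmetrize h ⟩
  + 2 * ∑[ u < n ] ∑[ v < n ] h u v
    ≡⟨ cong (+ 2 *_) (sum-cong-≗ row) ⟩
  + 2 * ∑[ u < n ] (+ n * (f u * f u) - ∑f * f u)
    ≡⟨ cong (+ 2 *_) (∑-distrib-- (λ u → + n * (f u * f u)) (λ u → ∑f * f u)) ⟩
  + 2 * (∑[ u < n ] (+ n * (f u * f u)) - ∑[ u < n ] (∑f * f u))
    ≡⟨ cong (+ 2 *_) (cong₂ _-_ (*-distribˡ-sum (+ n) (λ u → f u * f u)) (*-distribˡ-sum ∑f f)) ⟨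
  + 2 * (+ n * ∑[ u < n ] (f u * f u) - ∑f * ∑f)
    ∎
  where
  open ≡-Reasoning
  ∑f = ∑[ u < n ] f u
  h : Fin n → Fin n → ℤ
  h u v = f u * (f u - f v)
  square-split : ∀ a b → (a - b) * (a - b) ≡ a * (a - b) + b * (b - a)
  square-split = solve-∀
  row : ∀ u → ∑[ v < n ] h u v ≡ + n * (f u * f u) - ∑f * f u
  row u = begin
    ∑[ v < n ] (f u * (f u - f v))     ≡⟨ *-distribˡ-sum (f u) (λ v → f u - f v) ⟨
    f u * ∑[ v < n ] (f u - f v)       ≡⟨ cong (f u *_) (∑-distrib-- (λ _ → f u) f) ⟩
    f u * (∑[ v < n ] f u - ∑f)        ≡⟨ cong (λ s → f u * (s - ∑f)) (∑-const n (f u)) ⟩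
    f u * (+ n * f u - ∑f)             ≡⟨ expand (f u) (+ n) ∑f ⟩
    + n * (f u * f u) - ∑f * f u       ∎
    where
    expand : ∀ a k s → a * (k * a - s) ≡ k * (a * a) - s * a
    expand = solve-∀

Σpairs-square-difference : (f : Fin n → ℤ) →
  Σpairs (λ u v → (f u - f v) * (f u - f v))
    ≡ + n * ∑[ u < n ] (f u * f u) - ∑[ u < n ] f u * ∑[ u < n ] f u
Σpairs-square-difference f = ℤ.*-cancelˡ-≡ (+ 2) _ _
  (trans (Σpairs-double (λ u v → square-sym (f u) (f v)) (λ u → square-diag (f u)))
         (∑∑-square-difference f))
  where
  square-sym : ∀ a b → (a - b) * (a - b) ≡ (b - a) * (b - a)
  square-sym = solve-∀
  square-diag : ∀ a → (a - a) * (a - a) ≡ 0ℤ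
  square-diag = solve-∀

b2z-+-≤1 : {x y : Bool} → ¬ (x ≡ true × y ≡ true) → b2z x + b2z y ≤ 1ℤ
b2z-+-≤1 {true}  {true}  ¬both = ⊥-elim (¬both (refl , refl))
b2z-+-≤1 {true}  {false} _     = ℤ.≤-refl
b2z-+-≤1 {false} {true}  _     = ℤ.≤-refl
b2z-+-≤1 {false} {false} _     = +≤+ z≤n

b2z-+-≡1 : {x y : Bool} → b2z x + b2z y ≡ 1ℤ → x ≡ true ⊎ y ≡ true
b2z-+-≡1 {true}          _ = inj₁ refl
b2z-+-≡1 {false} {true}  _ = inj₂ refl

b2z-*-nonneg : (x : Bool) {k : ℤ} → (x ≡ true → 0ℤ ≤ k) → 0ℤ ≤ b2z x * k
b2z-*-nonneg true  {k} k≥0 = subst (0ℤ ≤_) (sym (ℤ.*-identityˡ k)) (k≥0 refl)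
b2z-*-nonneg false _       = ℤ.≤-refl

b2z-*-≡0 : (x : Bool) {k : ℤ} → (x ≡ true → k ≡ 0ℤ) → b2z x * k ≡ 0ℤ
b2z-*-≡0 true  {k} k≡0 = trans (ℤ.*-identityˡ k) (k≡0 refl)
b2z-*-≡0 false _       = refl

b2z-*-≡0⁻¹ : {x : Bool} {k : ℤ} → b2z x * k ≡ 0ℤ → x ≡ true → k ≡ 0ℤ
b2z-*-≡0⁻¹ {k = k} xk≡0 refl = trans (sym (ℤ.*-identityˡ k)) xk≡0

≡xor : {x a b : Bool} → (x ≡ true → ¬ a ≡ b) → (¬ a ≡ b → x ≡ true) → x ≡ a xor b
≡xor {true}  {true}  {true}  x⇒a≢b _ = ⊥-elim (x⇒a≢b refl refl)
≡xor {true}  {true}  {false} _ _     = refl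
≡xor {true}  {false} {true}  _ _     = refl
≡xor {true}  {false} {false} x⇒a≢b _ = ⊥-elim (x⇒a≢b refl refl)
≡xor {false} {true}  {true}  _ _     = refl
≡xor {false} {true}  {false} _ a≢b⇒x = a≢b⇒x (λ ())
≡xor {false} {false} {true}  _ a≢b⇒x = a≢b⇒x (λ ())
≡xor {false} {false} {false} _ _     = refl

b2z-xor-+ : (a b c : Bool) → a xor b ≡ true → b2z (a xor c) + b2z (b xor c) ≡ 1ℤ
b2z-xor-+ true  false true  _ = refl
b2z-xor-+ true  false false _ = refl
b2z-xor-+ false true  true  _ = refl
b2z-xor-+ false true  false _ = refl

+n*x≡0⇒x≡0 : {x : ℤ} → Fin n → + n * x ≡ 0ℤ → x ≡ 0ℤ
+n*x≡0⇒x≡0 {suc n} {x} _ n*x≡0 =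
  ℤ.*-cancelˡ-≡ (+ suc n) x 0ℤ (trans n*x≡0 (sym (ℤ.*-zeroʳ (+ suc n))))

degreeSquareSum : SimpleGraph n → ℤ
degreeSquareSum {n} G = ∑[ u < n ] (degree G u * degree G u)

-- For an edge uv of a triangle-free graph, the number of vertices adjacent to neither u nor v.
edgeSlack : SimpleGraph n → Fin n → Fin n → ℤ
edgeSlack {n} G u v = b2z (adj G u v) * (+ n - (degree G u + degree G v))

EdgeDegreeSumsMaximal : SimpleGraph n → Set
EdgeDegreeSumsMaximal {n} G = ∀ u v → adj G u v ≡ true → degree G u + degree G v ≡ + n

EdgesDominate : SimpleGraph n → Set
EdgesDominate G = ∀ u v → adj G u v ≡ true → ∀ w → adj G u w ≡ true ⊎ adj G v w ≡ true

module _ (G : SimpleGraph n) where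

  private
    a : Fin n → Fin n → ℤ
    a u v = b2z (adj G u v)

    d : Fin n → ℤ
    d = degree G

    a-sym : ∀ u v → a u v ≡ a v u
    a-sym u v = cong b2z (SimpleGraph.sym G u v)

  degree≡∑ : ∀ u → degree G u ≡ ∑[ v < n ] a u v
  degree≡∑ u = Σv≡∑ (a u)

  handshake : + 2 * edgeCount G ≡ ∑[ u < n ] degree G u
  handshake = trans (Σpairs-double a-sym (λ u → cong b2z (irrefl G u))) (sum-cong-≗ (sym ∘ degree≡∑))

  sigmaT≡ : sigmaT G ≡ + n * degreeSquareSum G - ∑[ u < n ] degree G u * ∑[ u < n ] degree G u
  sigmaT≡ = Σpairs-square-difference d

  ∑∑-adj-degree : ∑[ u < n ] ∑[ v < n ] (a u v * d u) ≡ degreeSquareSum G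
  ∑∑-adj-degree = sum-cong-≗ λ u → begin
    ∑[ v < n ] (a u v * d u)   ≡⟨ sum-cong-≗ (λ v → ℤ.*-comm (a u v) (d u)) ⟩
    ∑[ v < n ] (d u * a u v)   ≡⟨ *-distribˡ-sum (d u) (a u) ⟨
    d u * ∑[ v < n ] a u v     ≡⟨ cong (d u *_) (degree≡∑ u) ⟨
    d u * d u                  ∎
    where open ≡-Reasoning

  ∑∑-edgeSlack :
    ∑[ u < n ] ∑[ v < n ] edgeSlack G u v ≡ + 2 * (+ n * edgeCount G - degreeSquareSum G)
  ∑∑-edgeSlack = begin
    ∑[ u < n ] ∑[ v < n ] edgeSlack G u v
      ≡⟨ sum-cong-≗ (λ u → sum-cong-≗ (λ v → split u v)) ⟩
    ∑[ u < n ] ∑[ v < n ] (+ n * a u v - (k u v + k v u))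
      ≡⟨ sum-cong-≗ (λ u → ∑-distrib-- (λ v → + n * a u v) (λ v → k u v + k v u)) ⟩
    ∑[ u < n ] (∑[ v < n ] (+ n * a u v) - ∑[ v < n ] (k u v + k v u))
      ≡⟨ ∑-distrib-- (λ u → ∑[ v < n ] (+ n * a u v)) (λ u → ∑[ v < n ] (k u v + k v u)) ⟩
    ∑[ u < n ] ∑[ v < n ] (+ n * a u v) - ∑[ u < n ] ∑[ v < n ] (k u v + k v u)
      ≡⟨ cong₂ _-_ ∑∑-n*a (trans (∑∑-symmetrize k) (cong (+ 2 *_) ∑∑-adj-degree)) ⟩
    + n * (+ 2 * edgeCount G) - + 2 * degreeSquareSum G
      ≡⟨ regroup (+ n) (edgeCount G) (degreeSquareSum G) ⟩
    + 2 * (+ n * edgeCount G - degreeSquareSum G)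
      ∎
    where
    open ≡-Reasoning
    k : Fin n → Fin n → ℤ
    k u v = a u v * d u
    split : ∀ u v → edgeSlack G u v ≡ + n * a u v - (k u v + k v u)
    split u v = trans (expand (a u v) (+ n) (d u) (d v))
                      (cong (λ x → + n * a u v - (k u v + x * d v)) (a-sym u v))
      where
      expand : ∀ x k p q → x * (k - (p + q)) ≡ k * x - (x * p + x * q)
      expand = solve-∀
    ∑∑-n*a : ∑[ u < n ] ∑[ v < n ] (+ n * a u v) ≡ + n * (+ 2 * edgeCount G)
    ∑∑-n*a = begin
      ∑[ u < n ] ∑[ v < n ] (+ n * a u v)
        ≡⟨ sum-cong-≗ (λ u → trans (cong (+ n *_) (degree≡∑ u)) (*-distribˡ-sum (+ n) (a u))) ⟨
      ∑[ u < n ] (+ n * d u)                 ≡⟨ *-distribˡ-sum (+ n) d ⟨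
      + n * ∑[ u < n ] d u                   ≡⟨ cong (+ n *_) handshake ⟨
      + n * (+ 2 * edgeCount G)              ∎
    regroup : ∀ k m s → k * (+ 2 * m) - + 2 * s ≡ + 2 * (k * m - s)
    regroup = solve-∀

  sigmaT-gap : edgeCount G * (+ n * + n - + 4 * edgeCount G) - sigmaT G
                 ≡ + n * (+ n * edgeCount G - degreeSquareSum G)
  sigmaT-gap = begin
    R - sigmaT G                                           ≡⟨ cong (R -_) sigmaT≡ ⟩
    R - (+ n * degreeSquareSum G - ∑[ u < n ] d u * ∑[ u < n ] d u)
      ≡⟨ cong (λ D → R - (+ n * degreeSquareSum G - D * D)) handshake ⟨
    R - (+ n * degreeSquareSum G - + 2 * m * (+ 2 * m))     ≡⟨ regroup (+ n) m (degreeSquareSum G) ⟩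
    + n * (+ n * m - degreeSquareSum G)                    ∎
    where
    open ≡-Reasoning
    m = edgeCount G
    R = m * (+ n * + n - + 4 * m)
    regroup : ∀ k m s → m * (k * k - + 4 * m) - (k * s - + 2 * m * (+ 2 * m)) ≡ k * (k * m - s)
    regroup = solve-∀

  degree-+≡∑ : ∀ u v → degree G u + degree G v ≡ ∑[ w < n ] (a u w + a v w)
  degree-+≡∑ u v = trans (cong₂ _+_ (degree≡∑ u) (degree≡∑ v)) (sym (∑-distrib-+ (a u) (a v)))

  ∑-one : ∑[ w < n ] 1ℤ ≡ + n
  ∑-one = trans (∑-const n 1ℤ) (ℤ.*-identityʳ (+ n))

  maximal⇒degreeSquareSum≡ : EdgeDegreeSumsMaximal G → degreeSquareSum G ≡ + n * edgeCount G
  maximal⇒degreeSquareSum≡ maximal =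
    sym (ℤ.i-j≡0⇒i≡j _ _ (ℤ.*-cancelˡ-≡ (+ 2) _ 0ℤ (trans (sym ∑∑-edgeSlack) ∑∑slack≡0)))
    where
    slack≡0 : ∀ u v → edgeSlack G u v ≡ 0ℤ
    slack≡0 u v = b2z-*-≡0 (adj G u v) (λ uv → ℤ.i≡j⇒i-j≡0 (sym (maximal u v uv)))
    ∑∑slack≡0 : ∑[ u < n ] ∑[ v < n ] edgeSlack G u v ≡ 0ℤ
    ∑∑slack≡0 = ∑-zero (λ u → ∑-zero (slack≡0 u))

  completeBipartite⇒maximal : IsCompleteBipartite G → EdgeDegreeSumsMaximal G
  completeBipartite⇒maximal (c , bipartite) u v uv = begin
    degree G u + degree G v      ≡⟨ degree-+≡∑ u v ⟩
    ∑[ w < n ] (a u w + a v w)   ≡⟨ sum-cong-≗ one-side ⟩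
    ∑[ w < n ] 1ℤ                ≡⟨ ∑-one ⟩
    + n                          ∎
    where
    open ≡-Reasoning
    adj≡xor : ∀ x y → adj G x y ≡ c x xor c y
    adj≡xor x y = ≡xor (proj₁ (bipartite x y)) (proj₂ (bipartite x y))
    one-side : ∀ w → a u w + a v w ≡ 1ℤ
    one-side w = trans (cong₂ (λ p q → b2z p + b2z q) (adj≡xor u w) (adj≡xor v w))
                       (b2z-xor-+ (c u) (c v) (c w) (trans (sym (adj≡xor u v)) uv))

  module _ (tf : TriangleFree G) where

    no-common-neighbour : ∀ {u v} → adj G u v ≡ true → ∀ w → a u w + a v w ≤ 1ℤ
    no-common-neighbour {u} {v} uv w = b2z-+-≤1 (λ (uw , vw) → tf u v w (uv , vw , uw))

    edge-degree-+-≤ : ∀ {u v} → adj G u v ≡ true → degree G u + degree G v ≤ + n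
    edge-degree-+-≤ {u} {v} uv = begin
      degree G u + degree G v    ≡⟨ degree-+≡∑ u v ⟩
      ∑[ w < n ] (a u w + a v w) ≤⟨ ∑-mono-≤ (no-common-neighbour uv) ⟩
      ∑[ w < n ] 1ℤ              ≡⟨ ∑-one ⟩
      + n                        ∎
      where open ℤ.≤-Reasoning

    edgeSlack-nonneg : ∀ u v → 0ℤ ≤ edgeSlack G u v
    edgeSlack-nonneg u v = b2z-*-nonneg (adj G u v) (ℤ.i≤j⇒0≤j-i ∘ edge-degree-+-≤)

    degreeSquareSum≤ : degreeSquareSum G ≤ + n * edgeCount G
    degreeSquareSum≤ = ℤ.0≤i-j⇒j≤i (ℤ.*-cancelˡ-≤-pos 0ℤ _ (+ 2)
      (subst (_≤_ 0ℤ) ∑∑-edgeSlack (∑-nonneg (λ u → ∑-nonneg (edgeSlack-nonneg u)))))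

    degreeSquareSum≡⇒maximal : degreeSquareSum G ≡ + n * edgeCount G → EdgeDegreeSumsMaximal G
    degreeSquareSum≡⇒maximal S≡nm u v uv = sym (ℤ.i-j≡0⇒i≡j (+ n) _ (b2z-*-≡0⁻¹ (slack≡0 u v) uv))
      where
      ∑∑slack≡0 : ∑[ u < n ] ∑[ v < n ] edgeSlack G u v ≡ 0ℤ
      ∑∑slack≡0 = trans ∑∑-edgeSlack (cong (+ 2 *_) (ℤ.i≡j⇒i-j≡0 (sym S≡nm)))
      slack≡0 : ∀ u v → edgeSlack G u v ≡ 0ℤ
      slack≡0 = ∑∑-nonneg-≡0 edgeSlack-nonneg ∑∑slack≡0

    maximal⇒edgesDominate : EdgeDegreeSumsMaximal G → EdgesDominate G
    maximal⇒edgesDominate maximal u v uv w =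
      b2z-+-≡1 (sym (ℤ.i-j≡0⇒i≡j 1ℤ _ (∑-nonneg-≡0 (ℤ.i≤j⇒0≤j-i ∘ no-common-neighbour uv) ∑≡0 w)))
      where
      open ≡-Reasoning
      ∑≡0 : ∑[ w < n ] (1ℤ - (a u w + a v w)) ≡ 0ℤ
      ∑≡0 = begin
        ∑[ w < n ] (1ℤ - (a u w + a v w))               ≡⟨ ∑-distrib-- (λ _ → 1ℤ) (λ w → a u w + a v w) ⟩
        ∑[ w < n ] 1ℤ - ∑[ w < n ] (a u w + a v w)      ≡⟨ cong₂ _-_ ∑-one (sym (degree-+≡∑ u v)) ⟩
        + n - (degree G u + degree G v)                 ≡⟨ ℤ.i≡j⇒i-j≡0 (sym (maximal u v uv)) ⟩
        0ℤ                                              ∎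

    edgesDominate⇒completeBipartite : EdgesDominate G → IsCompleteBipartite G
    edgesDominate⇒completeBipartite dominating with any? (λ u → any? (λ v → adj G u v ≟ true))
    ... | no ∄edge =
      (λ _ → true) , λ x y → (λ xy → ⊥-elim (∄edge (x , y , xy))) , (λ ≢ → ⊥-elim (≢ refl))
    ... | yes (u₀ , v₀ , u₀v₀) = adj G v₀ , λ x y → separated x y , joined x y
      where
      off-v₀ : ∀ {x} → adj G v₀ x ≡ false → adj G u₀ x ≡ true
      off-v₀ {x} v₀x with dominating u₀ v₀ u₀v₀ x
      ... | inj₁ u₀x = u₀x
      ... | inj₂ v₀x′ = ⊥-elim (not-¬ v₀x v₀x′)
      across : ∀ {x y} → adj G v₀ x ≡ true → adj G v₀ y ≡ false → adj G x y ≡ true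
      across {x} {y} v₀x v₀y with dominating v₀ x v₀x y
      ... | inj₁ v₀y′ = ⊥-elim (not-¬ v₀y v₀y′)
      ... | inj₂ xy = xy
      separated : ∀ x y → adj G x y ≡ true → ¬ adj G v₀ x ≡ adj G v₀ y
      separated x y xy same with adj G v₀ x in v₀x
      ... | true  = tf v₀ x y (v₀x , xy , sym same)
      ... | false = tf u₀ x y (off-v₀ v₀x , xy , off-v₀ (sym same))
      joined : ∀ x y → ¬ adj G v₀ x ≡ adj G v₀ y → adj G x y ≡ true
      joined x y differ with adj G v₀ x in v₀x | adj G v₀ y in v₀y
      ... | true  | true  = ⊥-elim (differ refl)
      ... | false | false = ⊥-elim (differ refl)
      ... | true  | false = across v₀x v₀y
      ... | false | true  = trans (SimpleGraph.sym G x y) (across v₀y v₀x)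

proposition10 : (n : ℕ) (G : SimpleGraph n) → TriangleFree G →
    (sigmaT G ≤ edgeCount G * ((+ n) * (+ n) - (+ 4) * edgeCount G))
      × (sigmaT G ≡ edgeCount G * ((+ n) * (+ n) - (+ 4) * edgeCount G) ⇔ IsCompleteBipartite G)
proposition10 n G tf = σ≤R , mk⇔ σ≡R⇒bipartite bipartite⇒σ≡R
  where
  R gap : ℤ
  R = edgeCount G * (+ n * + n - + 4 * edgeCount G)
  gap = + n * edgeCount G - degreeSquareSum G

  n*gap≥0 : 0ℤ ≤ + n * gap
  n*gap≥0 = subst (_≤ + n * gap) (ℤ.*-zeroʳ (+ n))
                  (ℤ.*-monoˡ-≤-nonNeg (+ n) (ℤ.i≤j⇒0≤j-i (degreeSquareSum≤ G tf)))

  σ≤R : sigmaT G ≤ R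
  σ≤R = ℤ.0≤i-j⇒j≤i (subst (0ℤ ≤_) (sym (sigmaT-gap G)) n*gap≥0)

  σ≡R⇒bipartite : sigmaT G ≡ R → IsCompleteBipartite G
  σ≡R⇒bipartite σ≡R = edgesDominate⇒completeBipartite G tf (maximal⇒edgesDominate G tf maximal)
    where
    -- A vertex u rules out n = 0, the one case in which n * gap = 0 says nothing about gap.
    gap≡0 : Fin n → gap ≡ 0ℤ
    gap≡0 u = +n*x≡0⇒x≡0 u (trans (sym (sigmaT-gap G)) (ℤ.i≡j⇒i-j≡0 (sym σ≡R)))
    maximal : EdgeDegreeSumsMaximal G
    maximal u = degreeSquareSum≡⇒maximal G tf (sym (ℤ.i-j≡0⇒i≡j _ _ (gap≡0 u))) u

  bipartite⇒σ≡R : IsCompleteBipartite G → sigmaT G ≡ R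
  bipartite⇒σ≡R bipartite = sym (ℤ.i-j≡0⇒i≡j R (sigmaT G) (begin
    R - sigmaT G   ≡⟨ sigmaT-gap G ⟩
    + n * gap      ≡⟨ cong (+ n *_) gap≡0 ⟩
    + n * 0ℤ       ≡⟨ ℤ.*-zeroʳ (+ n) ⟩
    0ℤ             ∎))
    where
    open ≡-Reasoning
    gap≡0 : gap ≡ 0ℤ
    gap≡0 = ℤ.i≡j⇒i-j≡0 (sym (maximal⇒degreeSquareSum≡ G (completeBipartite⇒maximal G bipartite)))
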